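{- For every odd integer $k \geq 5$, \[ P_k(k-2) < 0, \quad\text{where } P_k(m) = 2(m-1)^{k+1} + (k+1)(m-1)^{k} - 2(k+1)m^{k} + (k-1). \]
   Context: $P_k(m)$ equals $2(k+1)\left(S_{\mathbb{R}}(m-1,k) - m^k\right)$ with $S_{\mathbb{R}}(m-1,k) = \frac{(m-1)^{k+1}-1}{k+1} + \frac{1+(m-1)^k}{2}$. -}

module Defs where

open import Data.Nat using (ℕ; suc)
open import Data.Integer using (ℤ; +_; _+_; _-_; _*_; _^_)

P : ℕ → ℤ → ℤ
P k m = + 2 * (m - + 1) ^ (suc k) + (+ k + + 1) * (m - + 1) ^ k
        - + 2 * (+ k + + 1) * m ^ k + (+ k - + 1)

-- Put n = k - 3, so that m = k - 2 = n + 1 and m - 1 = n.  The positive terms of P k m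
-- collect to (3n + 4) n^k + n + 2, the negative one is 2 (n + 4) (n + 1)^k, and the first two
-- terms of the binomial expansion, (n + 1)^k ≥ n^k + k n^(k-1) = (2n + 3) n^(k-1), already make
-- the negative term win by at least (n^2 + 18 n + 24) n^(k-1) - (n + 2) > 0 once n ≥ 1.
module Submission where

open import Data.Nat as ℕ using (ℕ; zero; suc; z≤n; s≤s; _+_; _*_; _^_; _≤_; _≥_; _%_)
open import Data.Nat.Properties
  using (≤-trans; ≤-reflexive; m≤n+m; m≤m+n; m≤m*n; m^n≢0; +-monoʳ-<; *-monoʳ-≤)
  using (module ≤-Reasoning)
open import Data.Nat.Tactic.RingSolver using (solve-∀)
open import Data.Integer as ℤ using (ℤ; +_; _-_; _<_; 0ℤ; +<+)
import Data.Integer.Properties as ℤ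
import Data.Integer.Tactic.RingSolver as ℤ-RingSolver
open import Relation.Binary.PropositionalEquality
  using (_≡_; refl; sym; trans; cong; cong₂; subst; module ≡-Reasoning)

open import Defs

n^[1+j]+[1+j]n^j≤[1+n]^[1+j] : ∀ n j → n ^ suc j + suc j * n ^ j ≤ suc n ^ suc j
n^[1+j]+[1+j]n^j≤[1+n]^[1+j] n zero = ≤-reflexive (base n)
  where
  base : ∀ n → n * 1 + 1 * 1 ≡ (1 + n) * 1
  base = solve-∀
n^[1+j]+[1+j]n^j≤[1+n]^[1+j] n (suc j) = begin
  n * (n * y) + (2 + j) * (n * y)                ≤⟨ m≤m+n _ (suc j * y) ⟩
  n * (n * y) + (2 + j) * (n * y) + suc j * y    ≡⟨ factor n j y ⟩
  suc n * (n * y + suc j * y)                    ≤⟨ *-monoʳ-≤ (suc n) ih ⟩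
  suc n * suc n ^ suc j                          ∎
  where
  open ≤-Reasoning
  y = n ^ j
  ih : n * y + suc j * y ≤ suc n ^ suc j
  ih = n^[1+j]+[1+j]n^j≤[1+n]^[1+j] n j
  factor : ∀ n j y → n * (n * y) + (2 + j) * (n * y) + (1 + j) * y ≡ (1 + n) * (n * y + (1 + j) * y)
  factor = solve-∀

P⁺ P⁻ : ℕ → ℕ
P⁺ n = (3 * n + 4) * n ^ (3 + n) + (2 + n)
P⁻ n = 2 * (n + 4) * suc n ^ (3 + n)

P⁺<P⁻ : ∀ n → P⁺ n ℕ.< P⁻ n
P⁺<P⁻ zero = s≤s (s≤s (s≤s z≤n))
P⁺<P⁻ n@(suc _) = begin-strict
  (3 * n + 4) * (n * b) + (2 + n)         ≡⟨ expand n b ⟩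
  (3 * n * n + 4 * n) * b + (2 + n)       <⟨ +-monoʳ-< _ 2+n<c*b ⟩
  (3 * n * n + 4 * n) * b + c * b         ≡⟨ factor n b ⟩
  2 * (n + 4) * (n * b + (3 + n) * b)     ≤⟨ *-monoʳ-≤ (2 * (n + 4)) binomial ⟩
  2 * (n + 4) * suc n ^ (3 + n)           ∎
  where
  open ≤-Reasoning
  b = n ^ (2 + n)
  -- c = n² + 18n + 24, written so that 2 + n < c is an instance of m≤n+m
  c = n * n + 17 * n + 21 + (3 + n)
  2+n<c*b : 2 + n ℕ.< c * b
  2+n<c*b = ≤-trans (m≤n+m (3 + n) (n * n + 17 * n + 21)) (m≤m*n c b {{m^n≢0 n (2 + n)}})
  binomial : n * b + (3 + n) * b ≤ suc n ^ (3 + n)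
  binomial = n^[1+j]+[1+j]n^j≤[1+n]^[1+j] n (2 + n)
  expand : ∀ n b → (3 * n + 4) * (n * b) + (2 + n) ≡ (3 * n * n + 4 * n) * b + (2 + n)
  expand = solve-∀
  factor : ∀ n b → (3 * n * n + 4 * n) * b + (n * n + 17 * n + 21 + (3 + n)) * b
                   ≡ 2 * (n + 4) * (n * b + (3 + n) * b)
  factor = solve-∀

pos-^ : ∀ m k → + (m ^ k) ≡ (+ m) ℤ.^ k
pos-^ m zero = refl
pos-^ m (suc k) = trans (ℤ.pos-* m (m ^ k)) (cong (+ m ℤ.*_) (pos-^ m k))

P[3+n,1+n]≡P⁺-P⁻ : ∀ n → P (3 + n) (+ (3 + n) - + 2) ≡ + P⁺ n - + P⁻ n
P[3+n,1+n]≡P⁺-P⁻ n = begin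
  P (3 + n) (+ (3 + n) - + 2)                  ≡⟨ collect (+ n) ((+ n) ℤ.^ k) ((+ suc n) ℤ.^ k) ⟩
  E ((+ n) ℤ.^ k) ((+ suc n) ℤ.^ k)            ≡⟨ cong₂ E (pos-^ n k) (pos-^ (suc n) k) ⟨
  E (+ (n ^ k)) (+ (suc n ^ k))                ≡⟨ cong₂ _-_ pos-P⁺ pos-P⁻ ⟨
  + P⁺ n - + P⁻ n                              ∎
  where
  open ≡-Reasoning
  k = 3 + n
  E : ℤ → ℤ → ℤ
  E X Y = (+ 3 ℤ.* + n ℤ.+ + 4) ℤ.* X ℤ.+ (+ 2 ℤ.+ + n) - + 2 ℤ.* (+ n ℤ.+ + 4) ℤ.* Y
  -- the left side is P (3 + n) (+ (3 + n) - + 2) once the literal subtractions have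
  -- computed: m - 1 reduces to + n and k - 1 to + (2 + n)
  collect : ∀ N X Y → + 2 ℤ.* (N ℤ.* X) ℤ.+ ((+ 3 ℤ.+ N) ℤ.+ + 1) ℤ.* X
                        - + 2 ℤ.* ((+ 3 ℤ.+ N) ℤ.+ + 1) ℤ.* Y ℤ.+ (+ 2 ℤ.+ N)
                      ≡ (+ 3 ℤ.* N ℤ.+ + 4) ℤ.* X ℤ.+ (+ 2 ℤ.+ N) - + 2 ℤ.* (N ℤ.+ + 4) ℤ.* Y
  collect = ℤ-RingSolver.solve-∀
  pos-P⁺ : + P⁺ n ≡ (+ 3 ℤ.* + n ℤ.+ + 4) ℤ.* + (n ^ k) ℤ.+ (+ 2 ℤ.+ + n)
  pos-P⁺ = cong (ℤ._+ + (2 + n)) (trans (ℤ.pos-* (3 * n + 4) (n ^ k))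
                                       (cong (λ t → (t ℤ.+ + 4) ℤ.* + (n ^ k)) (ℤ.pos-* 3 n)))
  pos-P⁻ : + P⁻ n ≡ + 2 ℤ.* (+ n ℤ.+ + 4) ℤ.* + (suc n ^ k)
  pos-P⁻ = trans (ℤ.pos-* (2 * (n + 4)) (suc n ^ k))
                 (cong (ℤ._* + (suc n ^ k)) (ℤ.pos-* 2 (n + 4)))

i<j⇒i-j<0 : ∀ {i j} → i < j → i - j < 0ℤ
i<j⇒i-j<0 {i} {j} i<j = subst (i - j <_) (ℤ.+-inverseʳ j) (ℤ.+-monoˡ-< (ℤ.- j) i<j)

lemma11 : (k : ℕ) → k % 2 ≡ 1 → k ≥ 5 → P k (+ k - + 2) < 0ℤ
lemma11 (suc (suc (suc n))) _ _ =
  subst (_< 0ℤ) (sym (P[3+n,1+n]≡P⁺-P⁻ n)) (i<j⇒i-j<0 (+<+ (P⁺<P⁻ n)))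
lemma11 0 _ ()
lemma11 1 _ (s≤s ())
lemma11 2 _ (s≤s (s≤s ()))
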